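{- Let $n\ge 3$ and let $W_n$ be the wheel on $n+1$ vertices. Then $rc^\ell(W_n)=1$ if $n=3$; $rc^\ell(W_n)=2$ if $n\in\{4,5,6\}$; and $rc^\ell(W_n)=3$ if $n\ge 7$.
   Context: The wheel $W_n$ ($n\ge 3$) is obtained from the cycle $C_n$ by adding a new vertex adjacent to all vertices of the cycle. An edge-coloured path is rainbow if all its edges have distinct colours. An (not necessarily proper) edge-colouring of a connected graph is rainbow connected if any two vertices are joined by a rainbow path. An $r$-edge-list assignment of $G$ assigns to each edge $e$ a set $L(e)\subset\mathbb N$ with $|L(e)|\ge r$; an $L$-edge-colouring is an edge-colouring $c$ with $c(e)\in L(e)$ for all $e$. $rc^\ell(G)$ is the minimum integer $r$ such that for every $r$-edge-list assignment $L$ of $G$ there exists a rainbow connected $L$-edge-colouring of $G$. -}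

module Defs where

open import Data.Nat using (ℕ; zero; suc; _≤_; _<_; NonZero)
open import Data.Nat.DivMod using (_%_; m%n<n)
open import Data.Fin using (Fin; toℕ; fromℕ<)
open import Data.Product using (Σ; ∃; ∃-syntax; _×_; _,_; proj₁; proj₂)
open import Data.Sum using (_⊎_)
open import Data.List using (List; []; _∷_; length; map)
open import Data.List.Relation.Unary.All using (All)
open import Data.List.Relation.Unary.Unique.Propositional using (Unique)
open import Relation.Binary.PropositionalEquality using (_≡_)
open import Relation.Nullary using (¬_)

record Graph : Set₁ where
  field
    V    : Set
    E    : Set
    ends : E → V × V

open Graph public

Joins : (G : Graph) → E G → V G → V G → Set
Joins G e u w = (ends G e ≡ (u , w)) ⊎ (ends G e ≡ (w , u))

data Walk (G : Graph) : V G → V G → Set where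
  [] : ∀ {u} → Walk G u u
  step : ∀ {u w v} (e : E G) → Joins G e u w → Walk G w v → Walk G u v

walkVertices : ∀ {G u v} → Walk G u v → List (V G)
walkVertices {u = u} [] = u ∷ []
walkVertices {u = u} (step e _ p) = u ∷ walkVertices p

walkEdges : ∀ {G u v} → Walk G u v → List (E G)
walkEdges [] = []
walkEdges (step e _ p) = e ∷ walkEdges p

IsPath : ∀ {G u v} → Walk G u v → Set
IsPath p = Unique (walkVertices p)

IsRainbow : ∀ {G u v} → (E G → ℕ) → Walk G u v → Set
IsRainbow c p = Unique (map c (walkEdges p))

RainbowConnected : (G : Graph) → (E G → ℕ) → Set
RainbowConnected G c =
  ∀ (u v : V G) → Σ (Walk G u v) λ p → IsPath p × IsRainbow c p

-- An edge-list assignment: each L e is a subset of ℕ (a predicate).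
-- It is an r-edge-list assignment if every L e has at least r elements,
-- i.e. contains r pairwise distinct naturals.
IsListAssignment : (G : Graph) → ℕ → (E G → ℕ → Set) → Set
IsListAssignment G r L =
  ∀ (e : E G) → ∃[ xs ] (Unique xs × length xs ≡ r × All (L e) xs)

ListRC : Graph → ℕ → Set₁
ListRC G r = ∀ (L : E G → ℕ → Set) → IsListAssignment G r L →
  ∃[ c ] ((∀ e → L e (c e)) × RainbowConnected G c)

ListRCNumberIs : Graph → ℕ → Set₁
ListRCNumberIs G k = ListRC G k × (∀ r → r < k → ¬ ListRC G r)

data WheelV (n : ℕ) : Set where
  hub : WheelV n
  cyc : Fin n → WheelV n

data WheelE (n : ℕ) : Set where
  spoke : Fin n → WheelE n
  rim   : Fin n → WheelE n

cycNext : ∀ {n} → Fin n → Fin n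
cycNext {suc m} i = fromℕ< (m%n<n (suc (toℕ i)) (suc m))

wheelEnds : ∀ n → WheelE n → WheelV n × WheelV n
wheelEnds n (spoke i) = hub , cyc i
wheelEnds n (rim i)   = cyc i , cyc (cycNext i)

Wheel : ℕ → Graph
Wheel n = record { V = WheelV n ; E = WheelE n ; ends = wheelEnds n }

{-# OPTIONS --safe #-}
-- With every list equal to {0} no path with two edges is rainbow, and W_n (n ≥ 4)
-- has non-adjacent rim vertices. With every list equal to {0,1} a rainbow path has at most two
-- edges, so rim vertices at cyclic distance at least 3 are joined only through the hub and must
-- get different spoke colours; for n ≥ 7 the pairs at distance at least 3 contain the odd cycle
-- 0, 4, 1, 5, 2, 6, 3, which cannot be 2-coloured. From 3-lists, colour the spokes properly around the cycle and give each rim edge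
-- a colour avoiding its two spokes; then u and v are joined by spoke u, spoke v, or, if these
-- agree, by rim u, spoke (u+1), spoke v. From 2-lists (n ≤ 6), colour the rim properly along the
-- path 0, …, n-1, which joins all vertices two apart except n-1 and 1, and let the spoke colours
-- separate that pair and the opposite pairs of W₆. W₃ is complete, so any colouring works.
module Submission where

open import Defs
open import Data.Nat using (ℕ; zero; suc; _+_; _≤_; _<_; s≤s; z≤n; s≤s⁻¹; _%_)
open import Data.Nat.DivMod using (m%n<n; n%n≡0; m<n⇒m%n≡m)
open import Data.Nat.Properties using (≤-<-connex; ≤-refl; ≤-trans; m≤n⇒m⊓n≡m; _≟_; <⇒≱)
open import Data.Fin using (Fin; Fin′; zero; suc; toℕ; inject; inject₁; fromℕ; compare; less; equal; greater)
open import Data.Fin.Properties using (toℕ-fromℕ<; toℕ-injective; toℕ-inject₁; inject₁ℕ<; toℕ-fromℕ)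
  renaming (_≟_ to _≟ᶠ_)
open import Data.Product using (Σ; ∃-syntax; _×_; _,_; proj₁; proj₂; swap)
open import Data.Sum using (_⊎_; inj₁; inj₂; [_,_]′)
open import Data.Empty using (⊥)
open import Data.List using (List; []; _∷_; [_]; length; map; take)
open import Data.List.Properties using (length-map; length-take; length-removeAt′)
open import Data.List.Relation.Unary.All as All using (All; []; _∷_)
import Data.List.Relation.Unary.All.Properties as Allₚ
open import Data.List.Relation.Unary.AllPairs using ([]; _∷_)
open import Data.List.Relation.Unary.Any using (here; there; index)
open import Data.List.Membership.Propositional using (_∈_; _∉_; _─_)
open import Data.List.Membership.Propositional.Properties using (∈-map⁻)
open import Data.List.Membership.DecPropositional _≟_ using (_∈?_)
open import Data.List.Relation.Binary.Subset.Propositional using (_⊆_)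
open import Data.List.Relation.Unary.Unique.Propositional using (Unique)
import Data.List.Relation.Unary.Unique.Propositional.Properties as Uniqueₚ
open import Relation.Binary.PropositionalEquality
  using (_≡_; _≢_; refl; sym; trans; cong; subst; subst₂; ≢-sym; module ≡-Reasoning)
open import Relation.Nullary using (¬_; yes; no; contradiction)

∈-─ : ∀ {x y : ℕ} {ys} (x∈ys : x ∈ ys) → y ∈ ys → y ≢ x → y ∈ ys ─ x∈ys
∈-─ (here refl) (here refl) y≢x = contradiction refl y≢x
∈-─ (here _)    (there y∈ys) _  = y∈ys
∈-─ (there _)   (here refl)  _  = here refl
∈-─ (there x∈ys) (there y∈ys) y≢x = there (∈-─ x∈ys y∈ys y≢x)

∃-∉ : ∀ {xs ys : List ℕ} → Unique xs → length ys < length xs → ∃[ x ] (x ∈ xs × x ∉ ys)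
∃-∉ {x ∷ xs} {ys} (x≢xs ∷ unique) ys<xs with x ∈? ys
... | no x∉ys = x , here refl , x∉ys
... | yes x∈ys =
  let y , y∈xs , y∉ys─x = ∃-∉ unique (subst (_≤ length xs) (length-removeAt′ ys (index x∈ys)) (s≤s⁻¹ ys<xs))
      y≢x y≡x = All.lookup x≢xs y∈xs (sym y≡x)
  in  y , there y∈xs , λ y∈ys → y∉ys─x (∈-─ x∈ys y∈ys y≢x)

⊆⇒length≤ : ∀ {xs ys : List ℕ} → Unique xs → xs ⊆ ys → length xs ≤ length ys
⊆⇒length≤ {xs} {ys} unique xs⊆ys with ≤-<-connex (length xs) (length ys)
... | inj₁ xs≤ys = xs≤ys
... | inj₂ ys<xs = let (x , x∈xs , x∉ys) = ∃-∉ unique ys<xs in contradiction (xs⊆ys x∈xs) x∉ys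

both-≢⇒≡ : ∀ {cs : List ℕ} {x y z} → length cs < 3 → x ∈ cs → y ∈ cs → z ∈ cs → x ≢ z → y ≢ z → x ≡ y
both-≢⇒≡ {x = x} {y} cs<3 x∈cs y∈cs z∈cs x≢z y≢z with x ≟ y
... | yes x≡y = x≡y
... | no x≢y = contradiction (⊆⇒length≤ ((x≢y ∷ x≢z ∷ []) ∷ (y≢z ∷ []) ∷ [] ∷ []) xyz⊆cs) (<⇒≱ cs<3)
  where
  xyz⊆cs : x ∷ y ∷ _ ∷ [] ⊆ _
  xyz⊆cs (here refl)                 = x∈cs
  xyz⊆cs (there (here refl))         = y∈cs
  xyz⊆cs (there (there (here refl))) = z∈cs

RainbowPath : (G : Graph) → (E G → ℕ) → V G → V G → Set
RainbowPath G c u v = Σ (Walk G u v) λ p → IsPath p × IsRainbow c p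

module _ {G : Graph} (c : E G → ℕ) where

  path₀ : ∀ u → RainbowPath G c u u
  path₀ u = [] , [] ∷ [] , []

  path₁ : ∀ {u v} e → Joins G e u v → u ≢ v → RainbowPath G c u v
  path₁ e j u≢v = step e j [] , (u≢v ∷ []) ∷ [] ∷ [] , [] ∷ []

  path₂ : ∀ {u w v} e₁ e₂ → Joins G e₁ u w → Joins G e₂ w v →
          u ≢ w → u ≢ v → w ≢ v → c e₁ ≢ c e₂ → RainbowPath G c u v
  path₂ e₁ e₂ j₁ j₂ u≢w u≢v w≢v c₁≢c₂ =
    step e₁ j₁ (step e₂ j₂ []) ,
    (u≢w ∷ u≢v ∷ []) ∷ (w≢v ∷ []) ∷ [] ∷ [] ,
    (c₁≢c₂ ∷ []) ∷ [] ∷ []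

  path₃ : ∀ {u w x v} e₁ e₂ e₃ → Joins G e₁ u w → Joins G e₂ w x → Joins G e₃ x v →
          u ≢ w → u ≢ x → u ≢ v → w ≢ x → w ≢ v → x ≢ v →
          c e₁ ≢ c e₂ → c e₁ ≢ c e₃ → c e₂ ≢ c e₃ → RainbowPath G c u v
  path₃ e₁ e₂ e₃ j₁ j₂ j₃ u≢w u≢x u≢v w≢x w≢v x≢v c₁≢c₂ c₁≢c₃ c₂≢c₃ =
    step e₁ j₁ (step e₂ j₂ (step e₃ j₃ [])) ,
    (u≢w ∷ u≢x ∷ u≢v ∷ []) ∷ (w≢x ∷ w≢v ∷ []) ∷ (x≢v ∷ []) ∷ [] ∷ [] ,
    (c₁≢c₂ ∷ c₁≢c₃ ∷ []) ∷ (c₂≢c₃ ∷ []) ∷ [] ∷ []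

  rainbow-length≤ : ∀ {cs u v} → (∀ e → c e ∈ cs) → (p : Walk G u v) → IsRainbow c p →
                    length (walkEdges p) ≤ length cs
  rainbow-length≤ {cs} c∈cs p rainbow =
    subst (_≤ length cs) (length-map c (walkEdges p)) (⊆⇒length≤ rainbow colour∈cs)
    where
    colour∈cs : map c (walkEdges p) ⊆ cs
    colour∈cs x∈ with ∈-map⁻ c x∈
    ... | e , _ , refl = c∈cs e

Avoids : ℕ → (ℕ → Set) → Set
Avoids k P = ∀ ys → length ys ≤ k → ∃[ x ] (P x × x ∉ ys)

module _ {G : Graph} {L : E G → ℕ → Set} where

  take-assignment : ∀ {r s} → r ≤ s → IsListAssignment G s L → IsListAssignment G r L
  take-assignment {r} r≤s isL e =
    let xs , unique , length≡s , valid = isL e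
    in take r xs , Uniqueₚ.take⁺ r unique ,
       trans (length-take r xs) (m≤n⇒m⊓n≡m (subst (r ≤_) (sym length≡s) r≤s)) ,
       Allₚ.take⁺ r valid

  choose : ∀ {r} → IsListAssignment G (suc r) L → ∀ e → Avoids r (L e)
  choose isL e ys ys≤r =
    let xs , unique , length≡ , valid = isL e
        x , x∈xs , x∉ys = ∃-∉ unique (subst (length ys <_) (sym length≡) (s≤s ys≤r))
    in x , All.lookup valid x∈xs , x∉ys

module TwoListChoice {G : Graph} {L : E G → ℕ → Set} (isL : IsListAssignment G 2 L) where

  some : E G → ℕ
  some e = proj₁ (choose {G} isL e [] z≤n)

  some-valid : ∀ e → L e (some e)
  some-valid e = proj₁ (proj₂ (choose {G} isL e [] z≤n))

  other : E G → ℕ → ℕ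
  other e a = proj₁ (choose {G} isL e [ a ] ≤-refl)

  other-valid : ∀ e a → L e (other e a)
  other-valid e a = proj₁ (proj₂ (choose {G} isL e [ a ] ≤-refl))

  other-≢ : ∀ e a → other e a ≢ a
  other-≢ e a eq = proj₂ (proj₂ (choose {G} isL e [ a ] ≤-refl)) (here eq)

ListRC-mono : ∀ {G r s} → r ≤ s → ListRC G r → ListRC G s
ListRC-mono {G} r≤s listRC L isL = listRC L (take-assignment {G} r≤s isL)

listRCNumberIs : ∀ {G k} → ListRC G (suc k) → ¬ ListRC G k → ListRCNumberIs G (suc k)
listRCNumberIs listRC ¬listRC = listRC , λ r r<1+k listRC-r → ¬listRC (ListRC-mono (s≤s⁻¹ r<1+k) listRC-r)

¬ListRC₀ : ∀ {G} → E G → ¬ ListRC G 0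
¬ListRC₀ e listRC with listRC (λ _ _ → ⊥) (λ _ → [] , [] , refl , [])
... | _ , valid , _ = valid e

¬ListRC₁ : ∀ {G} (u v : V G) → u ≢ v → (∀ e → ¬ Joins G e u v) → ¬ ListRC G 1
¬ListRC₁ {G} u v u≢v no-edge listRC
  with listRC (λ _ x → x ∈ [ 0 ]) (λ _ → [ 0 ] , [] ∷ [] , refl , here refl ∷ [])
... | c , zero∈ , connected with connected u v
...   | [] , _ = u≢v refl
...   | step e j [] , _ = no-edge e j
...   | p@(step _ _ (step _ _ _)) , _ , rainbow with rainbow-length≤ c zero∈ p rainbow
...     | s≤s ()

toℕ-cycNext : ∀ {m} (i : Fin (suc m)) → toℕ (cycNext i) ≡ suc (toℕ i) % suc m
toℕ-cycNext {m} i = toℕ-fromℕ< (m%n<n (suc (toℕ i)) (suc m))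

cycNext-inject₁ : ∀ {m} (i : Fin m) → cycNext (inject₁ i) ≡ suc i
cycNext-inject₁ {m} i = toℕ-injective (begin
  toℕ (cycNext (inject₁ i))      ≡⟨ toℕ-cycNext (inject₁ i) ⟩
  suc (toℕ (inject₁ i)) % suc m  ≡⟨ m<n⇒m%n≡m (s≤s (inject₁ℕ< i)) ⟩
  suc (toℕ (inject₁ i))          ≡⟨ cong suc (toℕ-inject₁ i) ⟩
  suc (toℕ i)                    ∎)
  where open ≡-Reasoning

cycNext-fromℕ : ∀ m → cycNext (fromℕ m) ≡ zero
cycNext-fromℕ m = toℕ-injective (begin
  toℕ (cycNext (fromℕ m))      ≡⟨ toℕ-cycNext (fromℕ m) ⟩
  suc (toℕ (fromℕ m)) % suc m  ≡⟨ cong (λ k → suc k % suc m) (toℕ-fromℕ m) ⟩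
  suc m % suc m                ≡⟨ n%n≡0 (suc m) ⟩
  0                            ∎)
  where open ≡-Reasoning

data InjectOrLast : ∀ {m} → Fin (suc m) → Set where
  inner : ∀ {m} (j : Fin m) → InjectOrLast (inject₁ j)
  last   : ∀ {m} → InjectOrLast (fromℕ m)

inject-or-last : ∀ {m} (i : Fin (suc m)) → InjectOrLast i
inject-or-last {zero}  zero    = last
inject-or-last {suc m} zero    = inner zero
inject-or-last {suc m} (suc i) with inject-or-last i
... | inner j = inner (suc j)
... | last     = last

ProperPathColouring : ∀ m → (Fin (suc m) → ℕ → Set) → Set
ProperPathColouring m P =
  Σ (Fin (suc m) → ℕ) λ s → (∀ i → P i (s i)) × (∀ (j : Fin m) → s (inject₁ j) ≢ s (suc j))

ProperCycleColouring : ∀ n → (Fin n → ℕ → Set) → Set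
ProperCycleColouring n P = Σ (Fin n → ℕ) λ s → (∀ i → P i (s i)) × (∀ i → s i ≢ s (cycNext i))

path-colouring : ∀ m {P : Fin (suc m) → ℕ → Set} → (∀ i → Avoids 1 (P i)) → ProperPathColouring m P
path-colouring zero avoids with avoids zero [] z≤n
... | x , px , _ = (λ _ → x) , (λ { zero → px }) , λ ()
path-colouring (suc m) {P} avoids = s , valid , proper
  where
  rest : ProperPathColouring m (λ i → P (suc i))
  rest = path-colouring m (λ i → avoids (suc i))
  t : Fin (suc m) → ℕ
  t = proj₁ rest
  head : ∃[ x ] (P zero x × x ∉ [ t zero ])
  head = avoids zero [ t zero ] (s≤s z≤n)
  s : Fin (2 + m) → ℕ
  s zero    = proj₁ head
  s (suc i) = t i
  valid : ∀ i → P i (s i)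
  valid zero    = proj₁ (proj₂ head)
  valid (suc i) = proj₁ (proj₂ rest) i
  proper : ∀ j → s (inject₁ j) ≢ s (suc j)
  proper zero    eq = proj₂ (proj₂ head) (here eq)
  proper (suc j) = proj₂ (proj₂ rest) j

cycle-colouring : ∀ m {P : Fin (2 + m) → ℕ → Set} → (∀ i → Avoids 2 (P i)) → ProperCycleColouring (2 + m) P
cycle-colouring m {P} avoids = s , valid , proper
  where
  path : ProperPathColouring m (λ i → P (suc i))
  path = path-colouring m (λ i ys ys≤1 → avoids (suc i) ys (≤-trans ys≤1 (s≤s z≤n)))
  t : Fin (suc m) → ℕ
  t = proj₁ path
  head : ∃[ x ] (P zero x × x ∉ t zero ∷ t (fromℕ m) ∷ [])
  head = avoids zero (t zero ∷ t (fromℕ m) ∷ []) ≤-refl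
  s : Fin (2 + m) → ℕ
  s zero    = proj₁ head
  s (suc i) = t i
  valid : ∀ i → P i (s i)
  valid zero    = proj₁ (proj₂ head)
  valid (suc i) = proj₁ (proj₂ path) i
  consecutive : ∀ j → s (inject₁ j) ≢ s (suc j)
  consecutive zero    eq = proj₂ (proj₂ head) (here eq)
  consecutive (suc j) = proj₂ (proj₂ path) j
  proper : ∀ i → s i ≢ s (cycNext i)
  proper i with inject-or-last i
  ... | inner j rewrite cycNext-inject₁ j = consecutive j
  ... | last rewrite cycNext-fromℕ (suc m) = λ eq → proj₂ (proj₂ head) (there (here (sym eq)))

-- Rim adjacency on the positions toℕ i rather than on Fin: in W (7 + k) the successor of vertex 6
-- does not reduce (whether it wraps depends on k), but with these ℕ-indexed families the absurd
-- patterns below refute nearness of concrete positions by unification alone.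
data Successor : ℕ → ℕ → ℕ → Set where
  next : ∀ {n x} → Successor n x (suc x)
  wrap : ∀ {x} → Successor (suc x) x 0

successor : ∀ {m} (i : Fin (suc m)) → Successor (suc m) (toℕ i) (toℕ (cycNext i))
successor i with inject-or-last i
... | inner j rewrite cycNext-inject₁ j | toℕ-inject₁ j = next
... | last {m} rewrite cycNext-fromℕ m | toℕ-fromℕ m = wrap

successor-injective : ∀ {n x y z} → Successor n x z → Successor n y z → x ≡ y
successor-injective next next = refl
successor-injective wrap wrap = refl

data Ahead : ℕ → ℕ → ℕ → Set where
  one       : ∀ {n x} → Ahead n x (suc x)
  one-wrap  : ∀ {x} → Ahead (suc x) x 0
  two       : ∀ {n x} → Ahead n x (suc (suc x))
  two-wrap₀ : ∀ {x} → Ahead (suc (suc x)) x 0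
  two-wrap₁ : ∀ {x} → Ahead (suc x) x 1

ahead₁ : ∀ {n x y} → Successor n x y → Ahead n x y
ahead₁ next = one
ahead₁ wrap = one-wrap

ahead₂ : ∀ {n x y z} → Successor n x y → Successor n y z → Ahead n x z
ahead₂ next next = two
ahead₂ next wrap = two-wrap₀
ahead₂ wrap next = two-wrap₁
ahead₂ wrap wrap = one-wrap

Ahead-irrefl : ∀ {m x} → ¬ Ahead (3 + m) x x
Ahead-irrefl ()

data Near (n x : ℕ) : ℕ → Set where
  same   : Near n x x
  ahead  : ∀ {y} → Ahead n x y → Near n x y
  behind : ∀ {y} → Ahead n y x → Near n x y

cyc-injective : ∀ {n} {i j : Fin n} → _≡_ {A = WheelV n} (cyc i) (cyc j) → i ≡ j
cyc-injective refl = refl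

Ahead⇒≢ : ∀ {m} {i j : Fin (3 + m)} → Ahead (3 + m) (toℕ i) (toℕ j) → _≢_ {A = WheelV (3 + m)} (cyc i) (cyc j)
Ahead⇒≢ {i = i} i→j eq = Ahead-irrefl (subst (Ahead _ (toℕ i)) (cong toℕ (sym (cyc-injective eq))) i→j)

cycNext-≢ : ∀ {m} (i : Fin (3 + m)) → _≢_ {A = WheelV (3 + m)} (cyc i) (cyc (cycNext i))
cycNext-≢ i = Ahead⇒≢ (ahead₁ (successor i))

cycNext²-≢ : ∀ {m} (i : Fin (3 + m)) → _≢_ {A = WheelV (3 + m)} (cyc i) (cyc (cycNext (cycNext i)))
cycNext²-≢ i = Ahead⇒≢ (ahead₂ (successor i) (successor (cycNext i)))

module _ {m : ℕ} where

  rim-step : ∀ {e} {i j : Fin (suc m)} → Joins (Wheel (suc m)) e (cyc i) (cyc j) →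
             j ≡ cycNext i ⊎ i ≡ cycNext j
  rim-step {rim _}   (inj₁ refl) = inj₁ refl
  rim-step {rim _}   (inj₂ refl) = inj₂ refl
  rim-step {spoke _} (inj₁ ())
  rim-step {spoke _} (inj₂ ())

  rim-step-near : ∀ {a b : Fin (suc m)} → b ≡ cycNext a ⊎ a ≡ cycNext b → Near (suc m) (toℕ a) (toℕ b)
  rim-step-near {a}     (inj₁ refl) = ahead (ahead₁ (successor a))
  rim-step-near {b = b} (inj₂ refl) = behind (ahead₁ (successor b))

  rim-steps-near : ∀ {a t b : Fin (suc m)} → t ≡ cycNext a ⊎ a ≡ cycNext t → b ≡ cycNext t ⊎ t ≡ cycNext b →
                   Near (suc m) (toℕ a) (toℕ b)
  rim-steps-near {a}     (inj₁ refl) (inj₁ refl) = ahead (ahead₂ (successor a) (successor (cycNext a)))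
  rim-steps-near {b = b} (inj₂ refl) (inj₂ refl) = behind (ahead₂ (successor b) (successor (cycNext b)))
  rim-steps-near         (inj₂ refl) (inj₁ refl) = same
  rim-steps-near {a} {b = b} (inj₁ refl) (inj₂ a⁺≡b⁺) =
    subst (Near _ (toℕ a)) (successor-injective (successor a) b→a⁺) same
    where
    b→a⁺ : Successor (suc m) (toℕ b) (toℕ (cycNext a))
    b→a⁺ = subst (Successor _ (toℕ b)) (cong toℕ (sym a⁺≡b⁺)) (successor b)

  spoke-into-hub : ∀ {e i} → Joins (Wheel (suc m)) e (cyc i) hub → e ≡ spoke i
  spoke-into-hub {spoke _} (inj₂ refl) = refl
  spoke-into-hub {rim _}   (inj₁ ())
  spoke-into-hub {rim _}   (inj₂ ())

  spoke-from-hub : ∀ {e i} → Joins (Wheel (suc m)) e hub (cyc i) → e ≡ spoke i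
  spoke-from-hub {spoke _} (inj₁ refl) = refl
  spoke-from-hub {rim _}   (inj₁ ())
  spoke-from-hub {rim _}   (inj₂ ())

module WheelPaths {m : ℕ} (c : WheelE (3 + m) → ℕ) where

  W : Graph
  W = Wheel (3 + m)

  rim-paths⇒connected : (∀ i j → RainbowPath W c (cyc i) (cyc j)) → RainbowConnected W c
  rim-paths⇒connected _ hub     hub     = path₀ c hub
  rim-paths⇒connected _ hub     (cyc j) = path₁ c (spoke j) (inj₁ refl) (λ ())
  rim-paths⇒connected _ (cyc i) hub     = path₁ c (spoke i) (inj₂ refl) (λ ())
  rim-paths⇒connected rim-paths (cyc i) (cyc j) = rim-paths i j

  hub-path : ∀ i j → c (spoke i) ≢ c (spoke j) → RainbowPath W c (cyc i) (cyc j)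
  hub-path i j sᵢ≢sⱼ = path₂ c (spoke i) (spoke j) (inj₂ refl) (inj₁ refl)
    (λ ()) (λ eq → sᵢ≢sⱼ (cong (λ k → c (spoke k)) (cyc-injective eq))) (λ ()) sᵢ≢sⱼ

  Linked : WheelV (3 + m) → WheelV (3 + m) → Set
  Linked u v = RainbowPath W c u v × RainbowPath W c v u

  linked⇒connected : (∀ j (i : Fin′ j) → Linked (cyc (inject i)) (cyc j)) → RainbowConnected W c
  linked⇒connected links = rim-paths⇒connected rim-paths
    where
    rim-paths : ∀ i j → RainbowPath W c (cyc i) (cyc j)
    rim-paths i j with compare i j
    ... | less    j i′ = proj₁ (links j i′)
    ... | equal   i    = path₀ c (cyc i)
    ... | greater i j′ = proj₂ (links i j′)

  hub-link : ∀ i j → c (spoke i) ≢ c (spoke j) → Linked (cyc i) (cyc j)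
  hub-link i j sᵢ≢sⱼ = hub-path i j sᵢ≢sⱼ , hub-path j i (≢-sym sᵢ≢sⱼ)

  rim-link : ∀ i → Linked (cyc i) (cyc (cycNext i))
  rim-link i = path₁ c (rim i) (inj₁ refl) (cycNext-≢ i) , path₁ c (rim i) (inj₂ refl) (≢-sym (cycNext-≢ i))

  rims-link : ∀ i → c (rim i) ≢ c (rim (cycNext i)) → Linked (cyc i) (cyc (cycNext (cycNext i)))
  rims-link i rᵢ≢rᵢ₊₁ =
    path₂ c (rim i) (rim (cycNext i)) (inj₁ refl) (inj₁ refl)
      (cycNext-≢ i) (cycNext²-≢ i) (cycNext-≢ (cycNext i)) rᵢ≢rᵢ₊₁ ,
    path₂ c (rim (cycNext i)) (rim i) (inj₂ refl) (inj₂ refl)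
      (≢-sym (cycNext-≢ (cycNext i))) (≢-sym (cycNext²-≢ i)) (≢-sym (cycNext-≢ i)) (≢-sym rᵢ≢rᵢ₊₁)

pattern v₀ = zero
pattern v₁ = suc v₀
pattern v₂ = suc v₁
pattern v₃ = suc v₂
pattern v₄ = suc v₃
pattern v₅ = suc v₄
pattern v₆ = suc v₅

wheel-¬ListRC₁ : ∀ k → ¬ ListRC (Wheel (4 + k)) 1
wheel-¬ListRC₁ k = ¬ListRC₁ (cyc v₀) (cyc v₂) (λ ()) λ _ j → [ (λ ()) , (λ ()) ]′ (rim-step j)

far-spokes-differ : ∀ {m} (c : WheelE (suc m) → ℕ) → (∀ e → c e ∈ 0 ∷ 1 ∷ []) →
                    ∀ {a b} → ¬ Near (suc m) (toℕ a) (toℕ b) →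
                    RainbowPath (Wheel (suc m)) c (cyc a) (cyc b) → c (spoke a) ≢ c (spoke b)
far-spokes-differ c bits far ([] , _) = contradiction same far
far-spokes-differ c bits far (step _ j [] , _) = contradiction (rim-step-near (rim-step j)) far
far-spokes-differ c bits far (step {w = hub} _ j₁ (step _ j₂ []) , _ , (c₁≢c₂ ∷ []) ∷ _) =
  subst₂ _≢_ (cong c (spoke-into-hub j₁)) (cong c (spoke-from-hub j₂)) c₁≢c₂
far-spokes-differ c bits far (step {w = cyc _} _ j₁ (step _ j₂ []) , _) =
  contradiction (rim-steps-near (rim-step j₁) (rim-step j₂)) far
far-spokes-differ c bits far (p@(step _ _ (step _ _ (step _ _ _))) , _ , rainbow)
  with rainbow-length≤ c bits p rainbow
... | s≤s (s≤s ())

wheel-¬ListRC₂ : ∀ k → ¬ ListRC (Wheel (7 + k)) 2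
wheel-¬ListRC₂ k listRC
  with listRC (λ _ x → x ∈ 0 ∷ 1 ∷ [])
              (λ _ → 0 ∷ 1 ∷ [] , ((λ ()) ∷ []) ∷ [] ∷ [] , refl , here refl ∷ there (here refl) ∷ [])
... | c , bits , connected = s₀≢s₃ (trans s₀≡s₁ (trans s₁≡s₂ s₂≡s₃))
  where
  s : Fin (7 + k) → ℕ
  s i = c (spoke i)
  far-apart : ∀ a b → ¬ Near (7 + k) (toℕ a) (toℕ b) → s a ≢ s b
  far-apart a b far = far-spokes-differ c bits far (connected (cyc a) (cyc b))
  both-differ-from : ∀ {a b} z → s a ≢ s z → s b ≢ s z → s a ≡ s b
  both-differ-from {a} {b} z = both-≢⇒≡ ≤-refl (bits (spoke a)) (bits (spoke b)) (bits (spoke z))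
  s₀≡s₁ : s v₀ ≡ s v₁
  s₀≡s₁ = both-differ-from v₄ (far-apart v₀ v₄ λ { (ahead ()) ; (behind ()) })
                              (far-apart v₁ v₄ λ { (ahead ()) ; (behind ()) })
  s₁≡s₂ : s v₁ ≡ s v₂
  s₁≡s₂ = both-differ-from v₅ (far-apart v₁ v₅ λ { (ahead ()) ; (behind ()) })
                              (far-apart v₂ v₅ λ { (ahead ()) ; (behind ()) })
  s₂≡s₃ : s v₂ ≡ s v₃
  s₂≡s₃ = both-differ-from v₆ (far-apart v₂ v₆ λ { (ahead ()) ; (behind ()) })
                              (far-apart v₃ v₆ λ { (ahead ()) ; (behind ()) })
  s₀≢s₃ : s v₀ ≢ s v₃
  s₀≢s₃ = far-apart v₀ v₃ λ { (ahead ()) ; (behind ()) }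

module ThreeListColouring {m} {L : WheelE (3 + m) → ℕ → Set} (isL : IsListAssignment (Wheel (3 + m)) 3 L) where

  spokes : ProperCycleColouring (3 + m) (λ i → L (spoke i))
  spokes = cycle-colouring (suc m) (λ i → choose {Wheel (3 + m)} isL (spoke i))

  s : Fin (3 + m) → ℕ
  s = proj₁ spokes

  rim-colour : ∀ i → ∃[ x ] (L (rim i) x × x ∉ s i ∷ s (cycNext i) ∷ [])
  rim-colour i = choose {Wheel (3 + m)} isL (rim i) _ ≤-refl

  c : WheelE (3 + m) → ℕ
  c (spoke i) = s i
  c (rim i)   = proj₁ (rim-colour i)

  valid : ∀ e → L e (c e)
  valid (spoke i) = proj₁ (proj₂ spokes) i
  valid (rim i)   = proj₁ (proj₂ (rim-colour i))

  open WheelPaths c public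

  rim-path : ∀ u v → RainbowPath W c (cyc u) (cyc v)
  rim-path u v with u ≟ᶠ v | s u ≟ s v
  ... | yes refl | _         = path₀ c (cyc u)
  ... | no u≢v   | no sᵤ≢sᵥ  = hub-path u v sᵤ≢sᵥ
  ... | no u≢v   | yes sᵤ≡sᵥ =
    path₃ c (rim u) (spoke (cycNext u)) (spoke v) (inj₁ refl) (inj₂ refl) (inj₁ refl)
      (cycNext-≢ u) (λ ()) (λ eq → u≢v (cyc-injective eq)) (λ ())
      (λ eq → sᵤ≢sᵤ₊₁ (trans sᵤ≡sᵥ (sym (cong s (cyc-injective eq))))) (λ ())
      (λ eq → rᵤ∉ (there (here eq))) (λ eq → rᵤ∉ (here (trans eq (sym sᵤ≡sᵥ))))
      (λ eq → sᵤ≢sᵤ₊₁ (trans sᵤ≡sᵥ (sym eq)))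
    where
    sᵤ≢sᵤ₊₁ : s u ≢ s (cycNext u)
    sᵤ≢sᵤ₊₁ = proj₂ (proj₂ spokes) u
    rᵤ∉ : c (rim u) ∉ s u ∷ s (cycNext u) ∷ []
    rᵤ∉ = proj₂ (proj₂ (rim-colour u))

wheel-listRC₃ : ∀ m → ListRC (Wheel (3 + m)) 3
wheel-listRC₃ m L isL = c , valid , rim-paths⇒connected rim-path
  where
  open ThreeListColouring isL

W₃-listRC₁ : ListRC (Wheel 3) 1
W₃-listRC₁ L isL = c , valid , linked⇒connected links
  where
  colour : ∀ e → ∃[ x ] (L e x × x ∉ [])
  colour e = choose {Wheel 3} isL e [] z≤n
  c : WheelE 3 → ℕ
  c e = proj₁ (colour e)
  valid : ∀ e → L e (c e)
  valid e = proj₁ (proj₂ (colour e))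
  open WheelPaths c
  links : ∀ j (i : Fin′ j) → Linked (cyc (inject i)) (cyc j)
  links v₀ ()
  links v₁ v₀ = rim-link v₀
  links v₂ v₀ = swap (rim-link v₂)
  links v₂ v₁ = rim-link v₁

module TwoListWheel {m} {L : WheelE (3 + m) → ℕ → Set} (isL : IsListAssignment (Wheel (3 + m)) 2 L) where

  open TwoListChoice {Wheel (3 + m)} isL public

  rims : ProperPathColouring (2 + m) (λ i → L (rim i))
  rims = path-colouring (2 + m) (λ i → choose {Wheel (3 + m)} isL (rim i))

  module WithSpokes (s : Fin (3 + m) → ℕ) (s-valid : ∀ i → L (spoke i) (s i)) where

    c : WheelE (3 + m) → ℕ
    c (spoke i) = s i
    c (rim i)   = proj₁ rims i

    valid : ∀ e → L e (c e)
    valid (spoke i) = s-valid i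
    valid (rim i)   = proj₁ (proj₂ rims) i

    rims-differ : ∀ j → c (rim (inject₁ j)) ≢ c (rim (suc j))
    rims-differ = proj₂ (proj₂ rims)

    open WheelPaths c public

W₄-listRC₂ : ListRC (Wheel 4) 2
W₄-listRC₂ L isL = c , valid , linked⇒connected links
  where
  open TwoListWheel isL
  open WithSpokes (λ i → some (spoke i)) (λ i → some-valid (spoke i))
  links : ∀ j (i : Fin′ j) → Linked (cyc (inject i)) (cyc j)
  links v₀ ()
  links v₁ v₀ = rim-link v₀
  links v₂ v₀ = rims-link v₀ (rims-differ v₀)
  links v₂ v₁ = rim-link v₁
  links v₃ v₀ = swap (rim-link v₃)
  links v₃ v₁ = rims-link v₁ (rims-differ v₁)
  links v₃ v₂ = rim-link v₂

W₅-listRC₂ : ListRC (Wheel 5) 2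
W₅-listRC₂ L isL = c , valid , linked⇒connected links
  where
  open TwoListWheel isL
  s : Fin 5 → ℕ
  s v₄ = other (spoke v₄) (s v₁)
  s i  = some (spoke i)
  s-valid : ∀ i → L (spoke i) (s i)
  s-valid v₀ = some-valid (spoke v₀)
  s-valid v₁ = some-valid (spoke v₁)
  s-valid v₂ = some-valid (spoke v₂)
  s-valid v₃ = some-valid (spoke v₃)
  s-valid v₄ = other-valid (spoke v₄) (s v₁)
  open WithSpokes s s-valid
  links : ∀ j (i : Fin′ j) → Linked (cyc (inject i)) (cyc j)
  links v₀ ()
  links v₁ v₀ = rim-link v₀
  links v₂ v₀ = rims-link v₀ (rims-differ v₀)
  links v₂ v₁ = rim-link v₁
  links v₃ v₀ = swap (rims-link v₃ (rims-differ v₃))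
  links v₃ v₁ = rims-link v₁ (rims-differ v₁)
  links v₃ v₂ = rim-link v₂
  links v₄ v₀ = swap (rim-link v₄)
  links v₄ v₁ = hub-link v₁ v₄ (≢-sym (other-≢ (spoke v₄) (s v₁)))
  links v₄ v₂ = rims-link v₂ (rims-differ v₂)
  links v₄ v₃ = rim-link v₃

W₆-listRC₂ : ListRC (Wheel 6) 2
W₆-listRC₂ L isL = c , valid , linked⇒connected links
  where
  open TwoListWheel isL
  s₅ : ℕ
  s₅ = other (spoke v₅) (some (spoke v₁))
  s : Fin 6 → ℕ
  s v₂ = other (spoke v₂) s₅
  s v₃ = other (spoke v₃) (s v₀)
  s v₄ = other (spoke v₄) (s v₁)
  s v₅ = s₅
  s i  = some (spoke i)
  s-valid : ∀ i → L (spoke i) (s i)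
  s-valid v₀ = some-valid (spoke v₀)
  s-valid v₁ = some-valid (spoke v₁)
  s-valid v₂ = other-valid (spoke v₂) s₅
  s-valid v₃ = other-valid (spoke v₃) (s v₀)
  s-valid v₄ = other-valid (spoke v₄) (s v₁)
  s-valid v₅ = other-valid (spoke v₅) (s v₁)
  open WithSpokes s s-valid
  links : ∀ j (i : Fin′ j) → Linked (cyc (inject i)) (cyc j)
  links v₀ ()
  links v₁ v₀ = rim-link v₀
  links v₂ v₀ = rims-link v₀ (rims-differ v₀)
  links v₂ v₁ = rim-link v₁
  links v₃ v₀ = hub-link v₀ v₃ (≢-sym (other-≢ (spoke v₃) (s v₀)))
  links v₃ v₁ = rims-link v₁ (rims-differ v₁)
  links v₃ v₂ = rim-link v₂
  links v₄ v₀ = swap (rims-link v₄ (rims-differ v₄))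
  links v₄ v₁ = hub-link v₁ v₄ (≢-sym (other-≢ (spoke v₄) (s v₁)))
  links v₄ v₂ = rims-link v₂ (rims-differ v₂)
  links v₄ v₃ = rim-link v₃
  links v₅ v₀ = swap (rim-link v₅)
  links v₅ v₁ = hub-link v₁ v₅ (≢-sym (other-≢ (spoke v₅) (s v₁)))
  links v₅ v₂ = hub-link v₂ v₅ (other-≢ (spoke v₂) s₅)
  links v₅ v₃ = rims-link v₃ (rims-differ v₃)
  links v₅ v₄ = rim-link v₄

W₄₋₆-listRC₂ : ∀ k → k ≤ 2 → ListRC (Wheel (4 + k)) 2
W₄₋₆-listRC₂ 0 _ = W₄-listRC₂
W₄₋₆-listRC₂ 1 _ = W₅-listRC₂
W₄₋₆-listRC₂ 2 _ = W₆-listRC₂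
W₄₋₆-listRC₂ (suc (suc (suc _))) (s≤s (s≤s ()))

rc-W₃ : ∀ n → n ≡ 3 → ListRCNumberIs (Wheel n) 1
rc-W₃ _ refl = listRCNumberIs W₃-listRC₁ (¬ListRC₀ (spoke v₀))

rc-W₄₋₆ : ∀ n → 4 ≤ n → n ≤ 6 → ListRCNumberIs (Wheel n) 2
rc-W₄₋₆ _ (s≤s (s≤s (s≤s (s≤s (z≤n {k}))))) (s≤s (s≤s (s≤s (s≤s k≤2)))) =
  listRCNumberIs (W₄₋₆-listRC₂ k k≤2) (wheel-¬ListRC₁ k)

rc-W≥₇ : ∀ n → 7 ≤ n → ListRCNumberIs (Wheel n) 3
rc-W≥₇ _ (s≤s (s≤s (s≤s (s≤s (s≤s (s≤s (s≤s (z≤n {k})))))))) =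
  listRCNumberIs (wheel-listRC₃ (4 + k)) (wheel-¬ListRC₂ k)

theorem3p7 : ∀ (n : ℕ) → 3 ≤ n →
    (n ≡ 3 → ListRCNumberIs (Wheel n) 1)
  × (4 ≤ n → n ≤ 6 → ListRCNumberIs (Wheel n) 2)
  × (7 ≤ n → ListRCNumberIs (Wheel n) 3)
theorem3p7 n _ = rc-W₃ n , rc-W₄₋₆ n , rc-W≥₇ n
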